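{- Let $G=\langle W,R,S,\nu\rangle$ be a quasi-frame. Then there is an adequate labeled $\mathbf{IL}$-frame $F=\langle W,R',S',\nu\rangle$ extending $G$, i.e. with the same domain and labeling, $R\subseteq R'$ and $S_x\subseteq S'_x$ for all $x\in W$.
   Context: Fix a logic $\mathbf{IL X}$ (the basic interpretability logic $\mathbf{IL}$ extended by some axiom schemata); "maximal consistent set" means maximal $\mathbf{IL X}$-consistent set. For such sets: $\Gamma\prec\Delta$ iff $\Box A\in\Gamma$ implies $A,\Box A\in\Delta$; $\Gamma\prec_C\Delta$ iff $A\rhd C\in\Gamma$ implies $\neg A,\Box\neg A\in\Delta$. A labeling on $\langle W,R,S\rangle$ (with $S=\{S_x\}_{x\in W}$) is a map $\nu$ assigning to every $x\in W$ a maximal consistent set $\nu(x)$ and to some pairs $\langle x,y\rangle$ with $xRy$ a formula $\nu(x,y)$. The $C$-critical cone above $x$, $\mathcal{C}^C_x$, is the smallest set with: $\nu(x,y)=C\Rightarrow y\in\mathcal{C}^C_x$; $x'\in\mathcal{C}^C_x\wedge x'S_xy\Rightarrow y\in\mathcal{C}^C_x$; $x'\in\mathcal{C}^C_x\wedge x'Ry\Rightarrow y\in\mathcal{C}^C_x$. The generalized $C$-cone $\mathcal{G}^C_x$ is the smallest set containing $\mathcal{C}^C_x$ and closed under $R$ and under $S_w$ for arbitrary $w$. A quasi-frame is $\langle W,R,S,\nu\rangle$ with $W$ non-empty, $\nu$ a labeling, such that: (1) $R$ is conversely well-founded; (2) $yS_xz\rightarrow xRy\wedge xRz$; (3) $xRy\rightarrow\nu(x)\prec\nu(y)$;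 (4) $A\neq B\rightarrow\mathcal{G}^A_x\cap\mathcal{G}^B_x=\varnothing$; (5) $y\in\mathcal{C}^A_x\rightarrow\nu(x)\prec_A\nu(y)$. An $\mathbf{IL}$-frame $\langle W,R,S\rangle$ is one with $R$ conversely well-founded and transitive, $yS_xz\rightarrow xRy\wedge xRz$, $xRy\rightarrow yS_xy$, $xRyRz\rightarrow yS_xz$, each $S_x$ transitive. An adequate labeled $\mathbf{IL}$-frame is an $\mathbf{IL}$-frame with a labeling satisfying (3), (4), (5). -}

module Defs where

open import Data.Nat using (ℕ)
open import Data.List using (List; []; _∷_; foldr)
open import Data.List.Relation.Unary.All using (All)
open import Data.Maybe using (Maybe; just)
open import Data.Product using (Σ; _×_; _,_)
open import Relation.Binary.PropositionalEquality using (_≡_; _≢_)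
open import Relation.Nullary using (¬_)
open import Induction.WellFounded using (WellFounded)
open import Function using (flip)

infixr 6 _⇒_
infix 7 _▷_

data Fm : Set where
  var : ℕ → Fm
  ⊥'  : Fm
  _⇒_ : Fm → Fm → Fm
  □   : Fm → Fm
  _▷_ : Fm → Fm → Fm

~_ : Fm → Fm
~ A = A ⇒ ⊥'

_∧'_ : Fm → Fm → Fm
A ∧' B = ~ (A ⇒ ~ B)

_∨'_ : Fm → Fm → Fm
A ∨' B = (~ A) ⇒ B

◇ : Fm → Fm
◇ A = ~ (□ (~ A))

sub : (ℕ → Fm) → Fm → Fm
sub σ (var n) = σ n
sub σ ⊥' = ⊥'
sub σ (A ⇒ B) = sub σ A ⇒ sub σ B
sub σ (□ A) = □ (sub σ A)
sub σ (A ▷ B) = sub σ A ▷ sub σ B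

SchemaSet : (Fm → Set) → Set
SchemaSet X = ∀ σ A → X A → X (sub σ A)

infix 4 _⊢_

data _⊢_ (X : Fm → Set) : Fm → Set where
  ax-K  : ∀ A B → X ⊢ A ⇒ B ⇒ A
  ax-S  : ∀ A B C → X ⊢ (A ⇒ B ⇒ C) ⇒ (A ⇒ B) ⇒ A ⇒ C
  ax-DN : ∀ A → X ⊢ (~ (~ A)) ⇒ A
  ax-L1 : ∀ A B → X ⊢ □ (A ⇒ B) ⇒ □ A ⇒ □ B
  ax-L2 : ∀ A → X ⊢ □ A ⇒ □ (□ A)
  ax-L3 : ∀ A → X ⊢ □ (□ A ⇒ A) ⇒ □ A
  ax-J1 : ∀ A B → X ⊢ □ (A ⇒ B) ⇒ (A ▷ B)
  ax-J2 : ∀ A B C → X ⊢ ((A ▷ B) ∧' (B ▷ C)) ⇒ (A ▷ C)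
  ax-J3 : ∀ A B C → X ⊢ ((A ▷ C) ∧' (B ▷ C)) ⇒ ((A ∨' B) ▷ C)
  ax-J4 : ∀ A B → X ⊢ (A ▷ B) ⇒ ◇ A ⇒ ◇ B
  ax-J5 : ∀ A → X ⊢ ◇ A ▷ A
  ax-X  : ∀ {A} → X A → X ⊢ A
  mp    : ∀ {A B} → X ⊢ A ⇒ B → X ⊢ A → X ⊢ B
  nec   : ∀ {A} → X ⊢ A → X ⊢ □ A

FmSet : Set₁
FmSet = Fm → Set

Consistent : (Fm → Set) → FmSet → Set
Consistent X Γ = ¬ (Σ (List Fm) λ L → All Γ L × (X ⊢ foldr _⇒_ ⊥' L))

MaxCons : (Fm → Set) → FmSet → Set₁
MaxCons X Γ = Consistent X Γ ×
  ((Δ : FmSet) → (∀ A → Γ A → Δ A) → Consistent X Δ → ∀ A → Δ A → Γ A)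

_≺_ : FmSet → FmSet → Set
Γ ≺ Δ = ∀ A → Γ (□ A) → Δ A × Δ (□ A)

≺[_] : Fm → FmSet → FmSet → Set
≺[ C ] Γ Δ = ∀ A → Γ (A ▷ C) → Δ (~ A) × Δ (□ (~ A))

-- Cones.  W domain, R : W → W → Set, S x y z means y S_x z,
-- νe x y ≡ just C means ν(x,y) = C (partial edge labeling).

module Cones {W : Set} (R : W → W → Set) (S : W → W → W → Set)
             (νe : W → W → Maybe Fm) where

  data Crit (C : Fm) (x : W) : W → Set where
    c-lab : ∀ {y} → νe x y ≡ just C → Crit C x y
    c-S   : ∀ {x' y} → Crit C x x' → S x x' y → Crit C x y
    c-R   : ∀ {x' y} → Crit C x x' → R x' y → Crit C x y

  data Gen (C : Fm) (x : W) : W → Set where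
    g-crit : ∀ {y} → Crit C x y → Gen C x y
    g-R    : ∀ {x' y} → Gen C x x' → R x' y → Gen C x y
    g-S    : ∀ {w x' y} → Gen C x x' → S w x' y → Gen C x y

open Cones public

record IsLabeling (X : Fm → Set) {W : Set} (R : W → W → Set)
                  (ν : W → FmSet) (νe : W → W → Maybe Fm) : Set₁ where
  field
    mcs      : ∀ x → MaxCons X (ν x)
    edge-R   : ∀ x y C → νe x y ≡ just C → R x y

-- conditions (3), (4), (5)
record Adequacy (X : Fm → Set) {W : Set} (R : W → W → Set)
                (S : W → W → W → Set) (ν : W → FmSet)
                (νe : W → W → Maybe Fm) : Set₁ where
  field
    labeling : IsLabeling X R ν νe
    R-≺      : ∀ x y → R x y → ν x ≺ ν y
    disjoint : ∀ x A B → A ≢ B → ∀ y →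
               ¬ (Gen R S νe A x y × Gen R S νe B x y)
    crit-≺   : ∀ x A y → Crit R S νe A x y → ≺[ A ] (ν x) (ν y)

record IsQuasiFrame (X : Fm → Set) {W : Set} (R : W → W → Set)
                    (S : W → W → W → Set) (ν : W → FmSet)
                    (νe : W → W → Maybe Fm) : Set₁ where
  field
    nonempty : W
    cwf      : WellFounded (flip R)
    S⊆R      : ∀ x y z → S x y z → R x y × R x z
    adequacy : Adequacy X R S ν νe

record IsILFrame {W : Set} (R : W → W → Set) (S : W → W → W → Set) : Set where
  field
    cwf      : WellFounded (flip R)
    R-trans  : ∀ x y z → R x y → R y z → R x z
    S⊆R      : ∀ x y z → S x y z → R x y × R x z
    S-refl   : ∀ x y → R x y → S x y y
    RR⊆S     : ∀ x y z → R x y → R y z → S x y z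
    S-trans  : ∀ x y z u → S x y z → S x z u → S x y u

record IsAdequateLabeledILFrame (X : Fm → Set) {W : Set} (R : W → W → Set)
                    (S : W → W → W → Set) (ν : W → FmSet)
                    (νe : W → W → Maybe Fm) : Set₁ where
  field
    ilFrame  : IsILFrame R S
    adequacy : Adequacy X R S ν νe

-- Take R' to be the transitive closure R⁺ of R, and let y S'ₓ z hold when x R⁺ y, x R⁺ z
-- and z is reached from y by finitely many S_x-steps and R⁺-steps.  These are exactly the
-- closure conditions of an IL-frame.  Critical and generalized cones are already closed
-- under R-steps and S-steps, so computing them in the extended frame yields the same sets;
-- hence conditions (4) and (5) carry over, and (3) does because ≺ is transitive.
module Submission where

open import Defs
open import Data.Maybe using (Maybe)
open import Data.Product using (Σ; _×_; _,_; proj₁; proj₂)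
open import Data.Sum using (_⊎_; inj₁; inj₂)
open import Function using (flip)
open import Induction.WellFounded using (WellFounded; module Subrelation)
open import Relation.Binary.Construct.Closure.Transitive as TC using (TransClosure; [_]; _∷_; _∷ʳ_; _++_)
open import Relation.Binary.Construct.Closure.ReflexiveTransitive using (Star; ε; _◅_; _◅◅_)

≺-trans : ∀ {Γ Δ Θ} → Γ ≺ Δ → Δ ≺ Θ → Γ ≺ Θ
≺-trans Γ≺Δ Δ≺Θ A □A∈Γ = Δ≺Θ A (proj₂ (Γ≺Δ A □A∈Γ))

reverse⁺ : ∀ {W : Set} {R : W → W → Set} {x y} → TransClosure R x y → TransClosure (flip R) y x
reverse⁺ [ r ] = [ r ]
reverse⁺ (r ∷ p) = reverse⁺ p ∷ʳ r

wellFounded-flip⁺ : ∀ {W : Set} {R : W → W → Set} →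
                    WellFounded (flip R) → WellFounded (flip (TransClosure R))
wellFounded-flip⁺ wf = Subrelation.wellFounded reverse⁺ (TC.wellFounded _ wf)

module ILClosure {W : Set} (R : W → W → Set) (S : W → W → W → Set) where

  R⁺ : W → W → Set
  R⁺ = TransClosure R

  SStep : W → W → W → Set
  SStep x y z = S x y z ⊎ R⁺ y z

  S⁺ : W → W → W → Set
  S⁺ x y z = R⁺ x y × R⁺ x z × Star (SStep x) y z

  S⊆S⁺ : (∀ x y z → S x y z → R x y × R x z) → ∀ x y z → S x y z → S⁺ x y z
  S⊆S⁺ S⊆R x y z s = [ proj₁ (S⊆R x y z s) ] , [ proj₂ (S⊆R x y z s) ] , (inj₁ s ◅ ε)

  isILFrame : WellFounded (flip R) → IsILFrame R⁺ S⁺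
  isILFrame cwf = record
    { cwf     = wellFounded-flip⁺ cwf
    ; R-trans = λ _ _ _ → _++_
    ; S⊆R     = λ _ _ _ (xy , xz , _) → xy , xz
    ; S-refl  = λ _ _ xy → xy , xy , ε
    ; RR⊆S    = λ _ _ _ xy yz → xy , xy ++ yz , (inj₂ yz ◅ ε)
    ; S-trans = λ _ _ _ _ (xy , _ , yz) (_ , xu , zu) → xy , xu , (yz ◅◅ zu)
    }

  module _ (νe : W → W → Maybe Fm) {C : Fm} {x : W} where

    Crit-R⁺ : ∀ {y z} → Crit R S νe C x y → R⁺ y z → Crit R S νe C x z
    Crit-R⁺ c [ r ] = c-R c r
    Crit-R⁺ c (r ∷ p) = Crit-R⁺ (c-R c r) p

    Crit-SStep⋆ : ∀ {y z} → Crit R S νe C x y → Star (SStep x) y z → Crit R S νe C x z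
    Crit-SStep⋆ c ε = c
    Crit-SStep⋆ c (inj₁ s ◅ p) = Crit-SStep⋆ (c-S c s) p
    Crit-SStep⋆ c (inj₂ r ◅ p) = Crit-SStep⋆ (Crit-R⁺ c r) p

    Crit-closure⊆Crit : ∀ {y} → Crit R⁺ S⁺ νe C x y → Crit R S νe C x y
    Crit-closure⊆Crit (c-lab e) = c-lab e
    Crit-closure⊆Crit (c-S c (_ , _ , p)) = Crit-SStep⋆ (Crit-closure⊆Crit c) p
    Crit-closure⊆Crit (c-R c r) = Crit-R⁺ (Crit-closure⊆Crit c) r

    Gen-R⁺ : ∀ {y z} → Gen R S νe C x y → R⁺ y z → Gen R S νe C x z
    Gen-R⁺ g [ r ] = g-R g r
    Gen-R⁺ g (r ∷ p) = Gen-R⁺ (g-R g r) p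

    Gen-SStep⋆ : ∀ {w y z} → Gen R S νe C x y → Star (SStep w) y z → Gen R S νe C x z
    Gen-SStep⋆ g ε = g
    Gen-SStep⋆ g (inj₁ s ◅ p) = Gen-SStep⋆ (g-S g s) p
    Gen-SStep⋆ g (inj₂ r ◅ p) = Gen-SStep⋆ (Gen-R⁺ g r) p

    Gen-closure⊆Gen : ∀ {y} → Gen R⁺ S⁺ νe C x y → Gen R S νe C x y
    Gen-closure⊆Gen (g-crit c) = g-crit (Crit-closure⊆Crit c)
    Gen-closure⊆Gen (g-R g r) = Gen-R⁺ (Gen-closure⊆Gen g) r
    Gen-closure⊆Gen (g-S g (_ , _ , p)) = Gen-SStep⋆ (Gen-closure⊆Gen g) p

  module _ {X : Fm → Set} {ν : W → FmSet} {νe : W → W → Maybe Fm} where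

    ≺-R⁺ : (∀ x y → R x y → ν x ≺ ν y) → ∀ x y → R⁺ x y → ν x ≺ ν y
    ≺-R⁺ R-≺ x y [ r ] = R-≺ x y r
    ≺-R⁺ R-≺ x y (_∷_ {y = m} r p) = ≺-trans {ν x} (R-≺ x m r) (≺-R⁺ R-≺ m y p)

    adequacy-closure : Adequacy X R S ν νe → Adequacy X R⁺ S⁺ ν νe
    adequacy-closure ad = record
      { labeling = record { mcs = mcs ; edge-R = λ x y C e → [ edge-R x y C e ] }
      ; R-≺      = ≺-R⁺ R-≺
      ; disjoint = λ x A B A≢B y (gA , gB) →
                     disjoint x A B A≢B y (Gen-closure⊆Gen νe gA , Gen-closure⊆Gen νe gB)
      ; crit-≺   = λ x A y c → crit-≺ x A y (Crit-closure⊆Crit νe c)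
      }
      where
      open Adequacy ad
      open IsLabeling labeling

lemma5p2 : (X : Fm → Set) → SchemaSet X →
           {W : Set} (R : W → W → Set) (S : W → W → W → Set)
           (ν : W → FmSet) (νe : W → W → Maybe Fm) →
           IsQuasiFrame X R S ν νe →
           Σ (W → W → Set) λ R' → Σ (W → W → W → Set) λ S' →
             IsAdequateLabeledILFrame X R' S' ν νe
             × (∀ x y → R x y → R' x y)
             × (∀ x y z → S x y z → S' x y z)
lemma5p2 X _ R S ν νe quasi =
  R⁺ , S⁺ ,
  record { ilFrame = isILFrame cwf ; adequacy = adequacy-closure adequacy } ,
  (λ _ _ → [_]) , S⊆S⁺ S⊆R
  where
  open IsQuasiFrame quasi
  open ILClosure R S
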